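{- Let $k\ge 3$ be an odd integer, set $m=(k-1)/2$, and for any integer $a$ define \[ F_k(a)=\sum_{i=1}^{m}\left\lfloor \frac{ai+m}{k}\right\rfloor. \] Then for any integer $a$ with $\gcd(a,k)=1$, \[ F_k(a)\equiv \begin{cases} 0 \pmod 2 & \text{if } a \text{ is odd},\\ \left\lfloor \frac{k+1}{4}\right\rfloor \pmod 2 & \text{if } a \text{ is even}.\end{cases} \] -}

module Defs where

open import Data.Nat as ℕ using (ℕ; zero; suc)
open import Data.Integer as ℤ using (ℤ; +_; _+_; _*_; _/ℕ_)

half : ℕ → ℕ
half k = (k ℕ.∸ 1) ℕ./ 2

sumFrom1 : ℕ → (ℕ → ℤ) → ℤ
sumFrom1 zero    f = + 0
sumFrom1 (suc n) f = sumFrom1 n f + f (suc n)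

F : (k : ℕ) .{{_ : ℕ.NonZero k}} → ℤ → ℤ
F k a = sumFrom1 (half k) (λ i → (a * + i + + half k) /ℕ k)

module Submission where

-- For 1 ≤ i ≤ m write a·i = rᵢ + qᵢ·k, where qᵢ = ⌊(a·i + m)/k⌋ and rᵢ ∈ [-m, m]
-- is the centred residue of a·i. As in Gauss's lemma, coprimality makes i ↦ |rᵢ| a permutation of
-- {1, …, m}: |rᵢ| = |rⱼ| forces k ∣ a·(i ∓ j), and 0 < |i ∓ j| < k unless i = j. Summing over i gives
-- a·T = T + D + F_k(a)·k with T = 1 + ⋯ + m and D = Σ (rᵢ − |rᵢ|) even; since k is odd this yields
-- F_k(a) ≡ (a − 1)·T (mod 2), and T = m(m+1)/2 ≡ ⌊(k+1)/4⌋ (mod 2).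

open import Defs
open import Data.Nat as ℕ using (ℕ; zero; suc; s≤s; _≤_; _<_; NonZero)
import Data.Nat.Properties as ℕ
open import Data.Nat.Divisibility using (_∣_)
import Data.Nat.Divisibility as ℕ
import Data.Nat.DivMod as ℕ
import Data.Nat.Coprimality as ℕ using (gcd≡1⇒coprime)
open import Data.Integer as ℤ using (ℤ; +_; -[1+_]; 0ℤ; 1ℤ; _+_; _*_; _-_; -_; ∣_∣; _%ℕ_; _/ℕ_)
import Data.Integer.Properties as ℤ
open import Data.Integer.DivMod using (n%ℕd<d; a≡a%ℕn+[a/ℕn]*n)
import Data.Integer.Divisibility as Unsigned
import Data.Integer.Divisibility.Signed as ℤ
open import Data.Integer.Tactic.RingSolver using (solve-∀)
import Data.Nat.Tactic.RingSolver as ℕSolver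
import Data.Integer.Coprimality as ℤ
open import Data.Fin as Fin using (Fin; toℕ; punchOut)
import Data.Fin.Properties as Fin
open import Data.Fin.Permutation using (Permutation; permutation)
open import Algebra.Properties.CommutativeMonoid.Sum ℤ.+-0-commutativeMonoid
  using (sum; sum-init-last; sum-cong-≗; sum-permute)
open import Data.Integer.GCD using (gcd)
open import Data.Product using (∃; _×_; _,_; proj₁; proj₂)
open import Data.Sum using (_⊎_; inj₁; inj₂)
open import Function using (_∘_; Injective)
open import Relation.Nullary using (¬_; yes; no; contradiction)
open import Relation.Binary.PropositionalEquality

m≤n+n⇒∣m⊖n∣≤n : ∀ {m n} → m ≤ n ℕ.+ n → ∣ m ℤ.⊖ n ∣ ≤ n
m≤n+n⇒∣m⊖n∣≤n {m} {n} m≤n+n with ℕ.≤-total m n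
... | inj₁ m≤n = subst (_≤ n) (sym (ℤ.∣⊖∣-≤ m≤n)) (ℕ.m∸n≤m n m)
... | inj₂ n≤m = subst (_≤ n) (sym (trans (ℤ.∣m⊖n∣≡∣n⊖m∣ m n) (ℤ.∣⊖∣-≤ n≤m))) (ℕ.m≤n+o⇒m∸n≤o m n m≤n+n)

2∤k⇒k≡1+half+half : ∀ k → ¬ (2 ∣ k) → k ≡ suc (half k ℕ.+ half k)
2∤k⇒k≡1+half+half k 2∤k = begin
  k                      ≡⟨ k≡1+[k/2]*2 ⟩
  suc (k ℕ./ 2 ℕ.* 2)    ≡⟨ cong suc (double (k ℕ./ 2)) ⟩
  suc (k ℕ./ 2 ℕ.+ k ℕ./ 2) ≡⟨ cong (λ h → suc (h ℕ.+ h)) half≡k/2 ⟨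
  suc (half k ℕ.+ half k) ∎
  where
  open ≡-Reasoning
  k%2≡1 : k ℕ.% 2 ≡ 1
  k%2≡1 with k ℕ.% 2 in eq | ℕ.m%n<n k 2
  ... | 0           | _              = contradiction (ℕ.m%n≡0⇒n∣m k 2 eq) 2∤k
  ... | 1           | _              = refl
  ... | suc (suc _) | s≤s (s≤s ())
  k≡1+[k/2]*2 : k ≡ suc (k ℕ./ 2 ℕ.* 2)
  k≡1+[k/2]*2 = trans (ℕ.m≡m%n+[m/n]*n k 2) (cong (ℕ._+ k ℕ./ 2 ℕ.* 2) k%2≡1)
  half≡k/2 : half k ≡ k ℕ./ 2
  half≡k/2 = trans (cong (λ n → (n ℕ.∸ 1) ℕ./ 2) k≡1+[k/2]*2) (ℕ.m*n/n≡m (k ℕ./ 2) 2)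
  double : ∀ h → h ℕ.* 2 ≡ h ℕ.+ h
  double = ℕSolver.solve-∀

<∧∣⇒≡0 : ∀ {d x} → ∣ x ∣ < d → + d Unsigned.∣ x → x ≡ 0ℤ
<∧∣⇒≡0 {x = x} ∣x∣<d d∣x with ∣ x ∣ in ∣x∣≡n
... | zero  = ℤ.∣i∣≡0⇒i≡0 ∣x∣≡n
... | suc _ = contradiction d∣x (ℕ.>⇒∤ ∣x∣<d)

∣x-x%ℕd : ∀ x d .{{_ : NonZero d}} → + d ℤ.∣ x - + (x %ℕ d)
∣x-x%ℕd x d = ℤ.divides (x /ℕ d) (begin
  x - + (x %ℕ d)                          ≡⟨ cong (_- + (x %ℕ d)) (a≡a%ℕn+[a/ℕn]*n x d) ⟩
  + (x %ℕ d) + x /ℕ d * + d - + (x %ℕ d)  ≡⟨ cancel (+ (x %ℕ d)) (x /ℕ d * + d) ⟩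
  x /ℕ d * + d                            ∎)
  where
  open ≡-Reasoning
  cancel : ∀ r y → r + y - r ≡ y
  cancel = solve-∀

∣x-n⇒x%ℕd≡n%d : ∀ {x} n d .{{_ : NonZero d}} → + d ℤ.∣ x - + n → x %ℕ d ≡ n ℕ.% d
∣x-n⇒x%ℕd≡n%d {x} n d d∣x-n = ℤ.+-injective (ℤ.i-j≡0⇒i≡j (+ s) (+ r) (<∧∣⇒≡0 ∣s-r∣<d (ℤ.∣⇒∣ᵤ d∣s-r)))
  where
  s = x %ℕ d
  r = n ℕ.% d
  d∣x-r : + d ℤ.∣ x - + r
  d∣x-r = subst (+ d ℤ.∣_) (regroup x (+ n) (+ r)) (ℤ.∣m∣n⇒∣m+n d∣x-n (∣x-x%ℕd (+ n) d))
    where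
    regroup : ∀ x n r → (x - n) + (n - r) ≡ x - r
    regroup = solve-∀
  d∣s-r : + d ℤ.∣ + s - + r
  d∣s-r = subst (+ d ℤ.∣_) (cancel x (+ s) (+ r)) (ℤ.∣m∣n⇒∣m-n d∣x-r (∣x-x%ℕd x d))
    where
    cancel : ∀ x s r → (x - r) - (x - s) ≡ s - r
    cancel = solve-∀
  ∣s-r∣<d : ∣ + s - + r ∣ < d
  ∣s-r∣<d = subst (_< d) (cong ∣_∣ (sym (ℤ.m-n≡m⊖n s r)))
              (ℕ.≤-<-trans (ℤ.∣m⊝n∣≤m⊔n s r) (ℕ.⊔-lub (n%ℕd<d x d) (ℕ.m%n<n n d)))

2∤x⇒2∣x-1 : ∀ {x} → ¬ (+ 2 ℤ.∣ x) → + 2 ℤ.∣ x - 1ℤ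
2∤x⇒2∣x-1 {x} 2∤x with x %ℕ 2 | n%ℕd<d x 2 | ∣x-x%ℕd x 2
... | 0 | _ | 2∣x-0 = contradiction (subst (+ 2 ℤ.∣_) (ℤ.+-identityʳ x) 2∣x-0) 2∤x
... | 1 | _ | 2∣x-1 = 2∣x-1
... | suc (suc _) | s≤s (s≤s ()) | _

2∣i-∣i∣ : ∀ i → + 2 ℤ.∣ i - + ∣ i ∣
2∣i-∣i∣ (+ n)    = ℤ.divides 0ℤ (ℤ.+-inverseʳ (+ n))
2∣i-∣i∣ -[1+ n ] = ℤ.divides -[1+ n ] (double -[1+ n ])
  where
  double : ∀ x → x + x ≡ x * + 2
  double = solve-∀

∣i∣≡∣j∣⇒i≡j⊎i≡-j : ∀ {i j} → ∣ i ∣ ≡ ∣ j ∣ → i ≡ j ⊎ i ≡ - j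
∣i∣≡∣j∣⇒i≡j⊎i≡-j {+ m}      {+ n}      eq   = inj₁ (cong +_ eq)
∣i∣≡∣j∣⇒i≡j⊎i≡-j {+ m}      { -[1+ n ]} eq   = inj₂ (cong +_ eq)
∣i∣≡∣j∣⇒i≡j⊎i≡-j { -[1+ m ]} {+ n}      refl = inj₂ refl
∣i∣≡∣j∣⇒i≡j⊎i≡-j { -[1+ m ]} { -[1+ n ]} refl = inj₁ refl

sumFrom1-cong : ∀ n {f g : ℕ → ℤ} → (∀ i → f i ≡ g i) → sumFrom1 n f ≡ sumFrom1 n g
sumFrom1-cong zero    f≗g = refl
sumFrom1-cong (suc n) f≗g = cong₂ _+_ (sumFrom1-cong n f≗g) (f≗g (suc n))

sumFrom1-distrib-+ : ∀ n (f g : ℕ → ℤ) → sumFrom1 n (λ i → f i + g i) ≡ sumFrom1 n f + sumFrom1 n g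
sumFrom1-distrib-+ zero    f g = refl
sumFrom1-distrib-+ (suc n) f g = begin
  sumFrom1 n (λ i → f i + g i) + (f (suc n) + g (suc n))
    ≡⟨ cong (_+ (f (suc n) + g (suc n))) (sumFrom1-distrib-+ n f g) ⟩
  sumFrom1 n f + sumFrom1 n g + (f (suc n) + g (suc n))
    ≡⟨ interchange (sumFrom1 n f) (sumFrom1 n g) (f (suc n)) (g (suc n)) ⟩
  sumFrom1 n f + f (suc n) + (sumFrom1 n g + g (suc n)) ∎
  where
  open ≡-Reasoning
  interchange : ∀ a b c d → a + b + (c + d) ≡ a + c + (b + d)
  interchange = solve-∀

sumFrom1-distribˡ-* : ∀ n c (f : ℕ → ℤ) → sumFrom1 n (λ i → c * f i) ≡ c * sumFrom1 n f
sumFrom1-distribˡ-* zero    c f = sym (ℤ.*-zeroʳ c)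
sumFrom1-distribˡ-* (suc n) c f = begin
  sumFrom1 n (λ i → c * f i) + c * f (suc n) ≡⟨ cong (_+ c * f (suc n)) (sumFrom1-distribˡ-* n c f) ⟩
  c * sumFrom1 n f + c * f (suc n)           ≡⟨ ℤ.*-distribˡ-+ c (sumFrom1 n f) (f (suc n)) ⟨
  c * (sumFrom1 n f + f (suc n))             ∎
  where open ≡-Reasoning

sumFrom1-distribʳ-* : ∀ n c (f : ℕ → ℤ) → sumFrom1 n (λ i → f i * c) ≡ sumFrom1 n f * c
sumFrom1-distribʳ-* n c f = begin
  sumFrom1 n (λ i → f i * c) ≡⟨ sumFrom1-cong n (λ i → ℤ.*-comm (f i) c) ⟩
  sumFrom1 n (λ i → c * f i) ≡⟨ sumFrom1-distribˡ-* n c f ⟩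
  c * sumFrom1 n f           ≡⟨ ℤ.*-comm c (sumFrom1 n f) ⟩
  sumFrom1 n f * c           ∎
  where open ≡-Reasoning

sumFrom1-∣ : ∀ n {d} {f : ℕ → ℤ} → (∀ i → d ℤ.∣ f i) → d ℤ.∣ sumFrom1 n f
sumFrom1-∣ zero    d∣f = ℤ.divides 0ℤ refl
sumFrom1-∣ (suc n) d∣f = ℤ.∣m∣n⇒∣m+n (sumFrom1-∣ n d∣f) (d∣f (suc n))

sumFrom1≡sum : ∀ n (f : ℕ → ℤ) → sumFrom1 n f ≡ sum {n} (f ∘ suc ∘ toℕ)
sumFrom1≡sum zero    f = refl
sumFrom1≡sum (suc n) f = sym (begin
  sum {suc n} (f ∘ suc ∘ toℕ)                                 ≡⟨ sum-init-last {n} (f ∘ suc ∘ toℕ) ⟩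
  sum {n} (f ∘ suc ∘ toℕ ∘ Fin.inject₁) + f (suc (toℕ (Fin.fromℕ n)))
    ≡⟨ cong₂ _+_ (sum-cong-≗ {n} (cong (f ∘ suc) ∘ Fin.toℕ-inject₁)) (cong (f ∘ suc) (Fin.toℕ-fromℕ n)) ⟩
  sum {n} (f ∘ suc ∘ toℕ) + f (suc n)                         ≡⟨ cong (_+ f (suc n)) (sumFrom1≡sum n f) ⟨
  sumFrom1 n f + f (suc n)                                    ∎)
  where open ≡-Reasoning

injective⇒surjective : ∀ {n} {σ : Fin n → Fin n} → Injective _≡_ _≡_ σ → ∀ y → ∃ λ x → σ x ≡ y
injective⇒surjective {suc n} {σ} σ-inj y with Fin.any? (λ x → σ x Fin.≟ y)
... | yes hit = hit
... | no miss = contradiction (Fin.injective⇒≤ σ-punchOut-injective) ℕ.1+n≰n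
  where
  y≢σ : ∀ x → y ≢ σ x
  y≢σ x y≡σx = miss (x , sym y≡σx)
  σ-punchOut-injective : Injective _≡_ _≡_ (λ x → punchOut (y≢σ x))
  σ-punchOut-injective = σ-inj ∘ Fin.punchOut-injective (y≢σ _) (y≢σ _)

sum-injective : ∀ {n} (f : Fin n → ℤ) {σ : Fin n → Fin n} → Injective _≡_ _≡_ σ → sum (f ∘ σ) ≡ sum f
sum-injective f {σ} σ-inj = sym (sum-permute f π)
  where
  σ⁻¹ : Fin _ → Fin _
  σ⁻¹ y = proj₁ (injective⇒surjective σ-inj y)
  π : Permutation _ _
  π = permutation σ σ⁻¹ (proj₂ ∘ injective⇒surjective σ-inj)
                        (λ x → σ-inj (proj₂ (injective⇒surjective σ-inj (σ x))))

sumFrom1-injective : ∀ n (s : ℕ → ℕ) →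
  (∀ {i} → 0 < i → i ≤ n → 0 < s i × s i ≤ n) →
  (∀ {i j} → 0 < i → i ≤ n → 0 < j → j ≤ n → s i ≡ s j → i ≡ j) →
  sumFrom1 n (λ i → + s i) ≡ sumFrom1 n (λ i → + i)
sumFrom1-injective n s s-range s-inj = begin
  sumFrom1 n (λ i → + s i)              ≡⟨ sumFrom1≡sum n (λ i → + s i) ⟩
  sum {n} (λ j → + s (suc (toℕ j)))     ≡⟨ sum-cong-≗ {n} (λ j → cong +_ (suc-toℕ-σ j)) ⟨
  sum {n} (λ j → + suc (toℕ (σ j)))     ≡⟨ sum-injective (λ j → + suc (toℕ j)) σ-injective ⟩
  sum {n} (λ j → + suc (toℕ j))         ≡⟨ sumFrom1≡sum n (λ i → + i) ⟨
  sumFrom1 n (λ i → + i)                    ∎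
  where
  open ≡-Reasoning
  0<suc : ∀ {x} → 0 < suc x
  0<suc = s≤s ℕ.z≤n
  pred< : ∀ {x} → 0 < x → x ≤ n → Fin n
  pred< {suc x} _ x<n = Fin.fromℕ< x<n
  suc-toℕ-pred< : ∀ {x} (0<x : 0 < x) (x≤n : x ≤ n) → suc (toℕ (pred< 0<x x≤n)) ≡ x
  suc-toℕ-pred< {suc x} _ x<n = cong suc (Fin.toℕ-fromℕ< x<n)
  σ : Fin n → Fin n
  σ j = let (0<s , s≤n) = s-range 0<suc (Fin.toℕ<n j) in pred< 0<s s≤n
  suc-toℕ-σ : ∀ j → suc (toℕ (σ j)) ≡ s (suc (toℕ j))
  suc-toℕ-σ j = let (0<s , s≤n) = s-range 0<suc (Fin.toℕ<n j) in suc-toℕ-pred< 0<s s≤n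
  σ-injective : Injective _≡_ _≡_ σ
  σ-injective {j} {j′} σj≡σj′ = Fin.toℕ-injective (ℕ.suc-injective
    (s-inj 0<suc (Fin.toℕ<n j) 0<suc (Fin.toℕ<n j′)
      (trans (sym (suc-toℕ-σ j)) (trans (cong (suc ∘ toℕ) σj≡σj′) (suc-toℕ-σ j′)))))

triangular-parity : ∀ m → + 2 ℤ.∣ sumFrom1 m (λ i → + i) - + ((suc (m ℕ.+ m) ℕ.+ 1) ℕ./ 4)
triangular-parity zero                = ℤ.divides 0ℤ refl
triangular-parity (suc zero)          = ℤ.divides 0ℤ refl
triangular-parity (suc (suc m)) = subst (+ 2 ℤ.∣_) regroup (ℤ.∣m∣n⇒∣m+n (triangular-parity m) (ℤ.divides x refl))
  where
  S = sumFrom1 m (λ i → + i)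
  x = + suc m
  q = (suc (m ℕ.+ m) ℕ.+ 1) ℕ./ 4
  numerator : ∀ n → suc (suc (suc n) ℕ.+ suc (suc n)) ℕ.+ 1 ≡ 4 ℕ.+ (suc (n ℕ.+ n) ℕ.+ 1)
  numerator = ℕSolver.solve-∀
  quotient-suc : (suc (suc (suc m) ℕ.+ suc (suc m)) ℕ.+ 1) ℕ./ 4 ≡ suc q
  quotient-suc = trans (ℕ./-congˡ {o = 4} (numerator m)) (ℕ.m/n≡1+[m∸n]/n {n = 4} (ℕ.m≤m+n 4 (suc (m ℕ.+ m) ℕ.+ 1)))
  -- + suc n computes to 1ℤ + + n, so the inductive step is a ring identity.
  shift : ∀ s y r → (s - r) + y * + 2 ≡ s + y + (1ℤ + y) - (1ℤ + r)
  shift = solve-∀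
  regroup : (S - + q) + x * + 2
          ≡ sumFrom1 (suc (suc m)) (λ i → + i) - + ((suc (suc (suc m) ℕ.+ suc (suc m)) ℕ.+ 1) ℕ./ 4)
  regroup = trans (shift S x (+ q)) (cong (λ n → S + x + (1ℤ + x) - + n) (sym quotient-suc))

module CentredResidues (k : ℕ) .{{_ : NonZero k}} (a : ℤ) (k⊥a : ℤ.Coprime (+ k) a)
                       (k≡1+2m : k ≡ suc (half k ℕ.+ half k)) where

  m : ℕ
  m = half k

  residue : ℕ → ℤ
  residue i = + ((a * + i + + m) %ℕ k) - + m

  floor : ℕ → ℤ
  floor i = (a * + i + + m) /ℕ k

  a*i≡residue+floor*k : ∀ i → a * + i ≡ residue i + floor i * + k
  a*i≡residue+floor*k i = begin
    a * + i                                         ≡⟨ shift (a * + i) (+ m) ⟩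
    (a * + i + + m) - + m                           ≡⟨ cong (_- + m) (a≡a%ℕn+[a/ℕn]*n (a * + i + + m) k) ⟩
    + ((a * + i + + m) %ℕ k) + floor i * + k - + m  ≡⟨ swap (+ ((a * + i + + m) %ℕ k)) (floor i * + k) (+ m) ⟩
    residue i + floor i * + k                       ∎
    where
    open ≡-Reasoning
    shift : ∀ x y → x ≡ x + y - y
    shift = solve-∀
    swap : ∀ r y z → r + y - z ≡ r - z + y
    swap = solve-∀

  ≤2m⇒<k : ∀ {x} → x ≤ m ℕ.+ m → x < k
  ≤2m⇒<k x≤2m = subst (_ <_) (sym k≡1+2m) (s≤s x≤2m)

  ∣residue∣≤m : ∀ i → ∣ residue i ∣ ≤ m
  ∣residue∣≤m i = subst (_≤ m) (cong ∣_∣ (sym (ℤ.m-n≡m⊖n _ m)))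
    (m≤n+n⇒∣m⊖n∣≤n (ℕ.s≤s⁻¹ (subst (r <_) k≡1+2m (n%ℕd<d (a * + i + + m) k))))
    where r = (a * + i + + m) %ℕ k

  k∣a*x⇒x≡0 : ∀ x → ∣ x ∣ < k → + k ℤ.∣ a * x → x ≡ 0ℤ
  k∣a*x⇒x≡0 x ∣x∣<k k∣ax = <∧∣⇒≡0 ∣x∣<k (ℤ.coprime-divisor (+ k) a x k⊥a (ℤ.∣⇒∣ᵤ k∣ax))

  residue-nonzero : ∀ {i} → 0 < i → i ≤ m → 0 < ∣ residue i ∣
  residue-nonzero {i} 0<i i≤m with ∣ residue i ∣ in ∣r∣≡0
  ... | suc _ = s≤s ℕ.z≤n
  ... | zero  = contradiction (ℤ.+-injective (k∣a*x⇒x≡0 (+ i) (≤2m⇒<k (ℕ.≤-trans i≤m (ℕ.m≤m+n m m)))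
                  (ℤ.divides (floor i) (trans (a*i≡residue+floor*k i)
                    (trans (cong (_+ floor i * + k) (ℤ.∣i∣≡0⇒i≡0 {residue i} ∣r∣≡0)) (ℤ.+-identityˡ _))))))
                  (ℕ.n>0⇒n≢0 0<i)

  a*[i-j]≡[floor-floor]*k : ∀ i j → residue i ≡ residue j → a * (+ i - + j) ≡ (floor i - floor j) * + k
  a*[i-j]≡[floor-floor]*k i j ri≡rj = begin
    a * (+ i - + j)                                        ≡⟨ distrib a (+ i) (+ j) ⟩
    a * + i - a * + j                                      ≡⟨ cong₂ _-_ (a*i≡residue+floor*k i) (a*i≡residue+floor*k j) ⟩
    (residue i + floor i * + k) - (residue j + floor j * + k)
      ≡⟨ cong (λ r → (r + floor i * + k) - (residue j + floor j * + k)) ri≡rj ⟩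
    (residue j + floor i * + k) - (residue j + floor j * + k) ≡⟨ cancel (residue j) (floor i) (floor j) (+ k) ⟩
    (floor i - floor j) * + k                              ∎
    where
    open ≡-Reasoning
    distrib : ∀ a x y → a * (x - y) ≡ a * x - a * y
    distrib = solve-∀
    cancel : ∀ r u v k → (r + u * k) - (r + v * k) ≡ (u - v) * k
    cancel = solve-∀

  a*[i+j]≡[floor+floor]*k : ∀ i j → residue i ≡ - residue j → a * (+ i + + j) ≡ (floor i + floor j) * + k
  a*[i+j]≡[floor+floor]*k i j ri≡-rj = begin
    a * (+ i + + j)                                        ≡⟨ ℤ.*-distribˡ-+ a (+ i) (+ j) ⟩
    a * + i + a * + j                                      ≡⟨ cong₂ _+_ (a*i≡residue+floor*k i) (a*i≡residue+floor*k j) ⟩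
    (residue i + floor i * + k) + (residue j + floor j * + k)
      ≡⟨ cong (λ r → (r + floor i * + k) + (residue j + floor j * + k)) ri≡-rj ⟩
    (- residue j + floor i * + k) + (residue j + floor j * + k) ≡⟨ cancel (residue j) (floor i) (floor j) (+ k) ⟩
    (floor i + floor j) * + k                              ∎
    where
    open ≡-Reasoning
    cancel : ∀ r u v k → (- r + u * k) + (r + v * k) ≡ (u + v) * k
    cancel = solve-∀

  ∣residue∣-injective : ∀ {i j} → 0 < i → i ≤ m → 0 < j → j ≤ m → ∣ residue i ∣ ≡ ∣ residue j ∣ → i ≡ j
  ∣residue∣-injective {i} {j} 0<i i≤m 0<j j≤m eq with ∣i∣≡∣j∣⇒i≡j⊎i≡-j eq
  ... | inj₁ ri≡rj = ℤ.+-injective (ℤ.i-j≡0⇒i≡j (+ i) (+ j)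
        (k∣a*x⇒x≡0 (+ i - + j) ∣i-j∣<k (ℤ.divides (floor i - floor j) (a*[i-j]≡[floor-floor]*k i j ri≡rj))))
    where
    ∣i-j∣<k : ∣ + i - + j ∣ < k
    ∣i-j∣<k = subst (_< k) (cong ∣_∣ (sym (ℤ.m-n≡m⊖n i j)))
      (≤2m⇒<k (ℕ.≤-trans (ℤ.∣m⊝n∣≤m⊔n i j) (ℕ.≤-trans (ℕ.⊔-lub i≤m j≤m) (ℕ.m≤m+n m m))))
  ... | inj₂ ri≡-rj = contradiction
        (ℤ.+-injective (k∣a*x⇒x≡0 (+ (i ℕ.+ j)) (≤2m⇒<k (ℕ.+-mono-≤ i≤m j≤m))
          (ℤ.divides (floor i + floor j) (a*[i+j]≡[floor+floor]*k i j ri≡-rj))))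
        (ℕ.n>0⇒n≢0 (ℕ.≤-trans 0<i (ℕ.m≤m+n i j)))

  triangular : ℤ
  triangular = sumFrom1 m (λ i → + i)

  defect : ℤ
  defect = sumFrom1 m (λ i → residue i - + ∣ residue i ∣)

  sum∣residue∣≡triangular : sumFrom1 m (λ i → + ∣ residue i ∣) ≡ triangular
  sum∣residue∣≡triangular = sumFrom1-injective m (λ i → ∣ residue i ∣)
    (λ 0<i i≤m → residue-nonzero 0<i i≤m , ∣residue∣≤m _) ∣residue∣-injective

  a*triangular≡triangular+defect+F*k : a * triangular ≡ triangular + defect + F k a * + k
  a*triangular≡triangular+defect+F*k = begin
    a * triangular
      ≡⟨ sumFrom1-distribˡ-* m a (λ i → + i) ⟨
    sumFrom1 m (λ i → a * + i)
      ≡⟨ sumFrom1-cong m (λ i → trans (a*i≡residue+floor*k i) (split (residue i) (+ ∣ residue i ∣) (floor i * + k))) ⟩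
    sumFrom1 m (λ i → (+ ∣ residue i ∣ + (residue i - + ∣ residue i ∣)) + floor i * + k)
      ≡⟨ sumFrom1-distrib-+ m _ (λ i → floor i * + k) ⟩
    sumFrom1 m (λ i → + ∣ residue i ∣ + (residue i - + ∣ residue i ∣)) + sumFrom1 m (λ i → floor i * + k)
      ≡⟨ cong₂ _+_ (sumFrom1-distrib-+ m (λ i → + ∣ residue i ∣) _) (sumFrom1-distribʳ-* m (+ k) floor) ⟩
    sumFrom1 m (λ i → + ∣ residue i ∣) + defect + F k a * + k
      ≡⟨ cong (λ x → x + defect + F k a * + k) sum∣residue∣≡triangular ⟩
    triangular + defect + F k a * + k ∎
    where
    open ≡-Reasoning
    split : ∀ r s y → r + y ≡ (s + (r - s)) + y
    split = solve-∀

  2∣F-[a-1]*triangular : + 2 ℤ.∣ F k a - (a - 1ℤ) * triangular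
  2∣F-[a-1]*triangular =
    subst (+ 2 ℤ.∣_) (sym rearrange) (ℤ.∣m∣n⇒∣m-n (ℤ.∣m⇒∣-m 2∣defect) (ℤ.divides (F k a * + m) refl))
    where
    open ≡-Reasoning
    2∣defect : + 2 ℤ.∣ defect
    2∣defect = sumFrom1-∣ m (λ i → 2∣i-∣i∣ (residue i))
    expand : ∀ f a t → f - (a - 1ℤ) * t ≡ f - (a * t - t)
    expand = solve-∀
    collect : ∀ f t d m → f - ((t + d + f * (1ℤ + (m + m))) - t) ≡ - d - (f * m) * + 2
    collect = solve-∀
    rearrange : F k a - (a - 1ℤ) * triangular ≡ - defect - (F k a * + m) * + 2
    rearrange = begin
      F k a - (a - 1ℤ) * triangular
        ≡⟨ expand (F k a) a triangular ⟩
      F k a - (a * triangular - triangular)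
        ≡⟨ cong (λ x → F k a - (x - triangular)) a*triangular≡triangular+defect+F*k ⟩
      F k a - ((triangular + defect + F k a * + k) - triangular)
        ≡⟨ cong (λ n → F k a - ((triangular + defect + F k a * + n) - triangular)) k≡1+2m ⟩
      F k a - ((triangular + defect + F k a * (1ℤ + (+ m + + m))) - triangular)
        ≡⟨ collect (F k a) triangular defect (+ m) ⟩
      - defect - (F k a * + m) * + 2                 ∎

lemma2p5 : (k : ℕ) .{{_ : NonZero k}} → 3 ≤ k → ¬ (2 ∣ k) →
    (a : ℤ) → gcd a (+ k) ≡ + 1 →
    (¬ (2 ∣ ℤ.∣ a ∣) → F k a %ℕ 2 ≡ 0) ×
    (2 ∣ ℤ.∣ a ∣ → F k a %ℕ 2 ≡ ((k ℕ.+ 1) ℕ./ 4) ℕ.% 2)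
lemma2p5 k _ 2∤k a gcd≡1 = odd-case , even-case
  where
  k≡1+2m : k ≡ suc (half k ℕ.+ half k)
  k≡1+2m = 2∤k⇒k≡1+half+half k 2∤k
  k⊥a : ℤ.Coprime (+ k) a
  k⊥a = ℤ.sym {a} {+ k} (ℕ.gcd≡1⇒coprime (ℤ.+-injective gcd≡1))
  open CentredResidues k a k⊥a k≡1+2m

  odd-case : ¬ (2 ∣ ∣ a ∣) → F k a %ℕ 2 ≡ 0
  odd-case 2∤a = ∣x-n⇒x%ℕd≡n%d {F k a} 0 2 (subst (+ 2 ℤ.∣_) (regroup (F k a) ((a - 1ℤ) * triangular)) 2∣F)
    where
    2∣[a-1]*triangular : + 2 ℤ.∣ (a - 1ℤ) * triangular
    2∣[a-1]*triangular = ℤ.∣m⇒∣m*n triangular (2∤x⇒2∣x-1 {a} (2∤a ∘ ℤ.∣⇒∣ᵤ))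
    2∣F : + 2 ℤ.∣ (F k a - (a - 1ℤ) * triangular) + (a - 1ℤ) * triangular
    2∣F = ℤ.∣m∣n⇒∣m+n 2∣F-[a-1]*triangular 2∣[a-1]*triangular
    regroup : ∀ f y → f - y + y ≡ f - + 0
    regroup = solve-∀

  even-case : 2 ∣ ∣ a ∣ → F k a %ℕ 2 ≡ ((k ℕ.+ 1) ℕ./ 4) ℕ.% 2
  even-case 2∣a = ∣x-n⇒x%ℕd≡n%d {F k a} n 2 (subst (+ 2 ℤ.∣_) (regroup (F k a) a triangular (+ n)) 2∣F-n)
    where
    n = (k ℕ.+ 1) ℕ./ 4
    2∣a*triangular : + 2 ℤ.∣ a * triangular
    2∣a*triangular = ℤ.∣m⇒∣m*n triangular (ℤ.∣ᵤ⇒∣ {+ 2} {a} 2∣a)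
    2∣triangular-n : + 2 ℤ.∣ triangular - + n
    2∣triangular-n = subst (λ l → + 2 ℤ.∣ triangular - + ((l ℕ.+ 1) ℕ./ 4)) (sym k≡1+2m) (triangular-parity m)
    2∣F-n : + 2 ℤ.∣ (F k a - (a - 1ℤ) * triangular) + a * triangular + (triangular - + n) + (- triangular) * + 2
    2∣F-n = ℤ.∣m∣n⇒∣m+n (ℤ.∣m∣n⇒∣m+n (ℤ.∣m∣n⇒∣m+n 2∣F-[a-1]*triangular 2∣a*triangular) 2∣triangular-n)
                         (ℤ.divides (- triangular) refl)
    regroup : ∀ f a t n → (f - (a - 1ℤ) * t) + a * t + (t - n) + (- t) * + 2 ≡ f - n
    regroup = solve-∀
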